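{- Let $G$ be a simple game and $G^*$ its dual. Then $f(G)=f(G^*)$ and $g(G)=g(G^*)$.
   Context: A simple game is $G=(P,W)$ with $P$ finite, $W\subseteq 2^P$ (winning coalitions) closed under supersets within $P$, $W\ne\emptyset$, $W\ne 2^P$; $L=2^P\setminus W$ is the set of losing coalitions. The dual game is $G^*=(P,\{P\setminus Y: Y\in L\})$, i.e. its winning coalitions are exactly the complements of losing coalitions of $G$. A trading transform of length $j$ is $(X_1,\dots,X_j;Y_1,\dots,Y_j)$ with every player in equally many $X_i$'s and $Y_i$'s; a certificate of non-weightedness has all $X_i$ winning and all $Y_i$ losing; it is potent if $P$ is among the $X_i$ and $\emptyset$ among the $Y_i$. $f(G)$ is the least length of a certificate of non-weightedness for $G$ (equivalently the least $k$ such that $G$ is not $k$-trade robust), $f(G)=\infty$ if none exists; $g(G)$ is the least length of a potent certificate of non-weightedness, $g(G)=\infty$ if none exists. -}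

module Defs where

open import Data.Nat using (ℕ; zero; suc; _+_; _<_)
open import Data.Bool using (Bool; true; false; not; if_then_else_)
open import Data.Fin using (Fin; zero; suc)
open import Data.Fin.Subset using (Subset; _⊆_; ⊤; ⊥; ∁)
open import Data.Vec using (lookup)
open import Data.Maybe using (Maybe; just; nothing)
open import Data.Product using (Σ; ∃; _×_)
open import Relation.Binary.PropositionalEquality using (_≡_)
open import Relation.Nullary using (¬_)
open import Function using (_∘_)

-- Players are Fin n; a coalition is a Subset n.
-- A game is given by its characteristic function W (true = winning).
record SimpleGame (n : ℕ) : Set where
  field
    W        : Subset n → Bool
    monotone : ∀ X Y → X ⊆ Y → W X ≡ true → W Y ≡ true
    nonEmpty : ∃ λ X → W X ≡ true
    notAll   : ∃ λ X → W X ≡ false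

dualW : ∀ {n} → (Subset n → Bool) → Subset n → Bool
dualW W S = not (W (∁ S))

count : ∀ {j} → (Fin j → Bool) → ℕ
count {zero}  f = 0
count {suc j} f = (if f zero then 1 else 0) + count (f ∘ suc)

IsTradingTransform : ∀ {n j} → (Fin j → Subset n) → (Fin j → Subset n) → Set
IsTradingTransform X Y = ∀ p → count (λ i → lookup (X i) p) ≡ count (λ i → lookup (Y i) p)

-- certificate of non-weightedness of length j for the game with winning predicate W
IsCertificate : ∀ {n} → (Subset n → Bool) → (j : ℕ) → (Fin j → Subset n) → (Fin j → Subset n) → Set
IsCertificate W j X Y =
  IsTradingTransform X Y × (∀ i → W (X i) ≡ true) × (∀ i → W (Y i) ≡ false)

HasCert : ∀ {n} → (Subset n → Bool) → ℕ → Set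
HasCert {n} W j = Σ (Fin j → Subset n) λ X → Σ (Fin j → Subset n) λ Y → IsCertificate W j X Y

HasPotentCert : ∀ {n} → (Subset n → Bool) → ℕ → Set
HasPotentCert {n} W j = Σ (Fin j → Subset n) λ X → Σ (Fin j → Subset n) λ Y →
  IsCertificate W j X Y × (∃ λ i → X i ≡ ⊤) × (∃ λ i → Y i ≡ ⊥)

-- "the least positive length j with property C is v" (v = nothing encodes ∞)
LeastLength : (ℕ → Set) → Maybe ℕ → Set
LeastLength C (just j) = (0 < j) × C j × (∀ k → 0 < k → k < j → ¬ C k)
LeastLength C nothing  = ∀ k → 0 < k → ¬ C k

-- f(G) = v  and  g(G) = v  (as relations; the values are unique)
fIs : ∀ {n} → (Subset n → Bool) → Maybe ℕ → Set
fIs W = LeastLength (HasCert W)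

gIs : ∀ {n} → (Subset n → Bool) → Maybe ℕ → Set
gIs W = LeastLength (HasPotentCert W)

-- Complementing every coalition of a certificate and swapping its two sides
-- turns a certificate for G into one for G* of the same length: complement
-- exchanges winning and losing between G and G*, every player lies in j − a
-- of the complemented sets when it lay in a of the originals, and P and ∅
-- are exchanged, so potency is kept. Since G** = G, the certificate lengths
-- of G and G* coincide, hence so do their least values.
module Submission where

open import Defs
open import Data.Nat using (ℕ; zero; suc; _+_)
open import Data.Nat.Properties using (+-suc; +-cancelʳ-≡)
open import Data.Bool using (Bool; true; false; not; if_then_else_)
open import Data.Bool.Properties using (not-involutive)
open import Data.Fin using (Fin; zero; suc)
open import Data.Fin.Subset using (Subset; ∁; ⊤; ⊥)
open import Data.Vec using (lookup; map)
open import Data.Vec.Properties using (lookup-map; map-∘; map-cong; map-id; map-replicate)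
open import Data.Maybe using (Maybe; just; nothing)
open import Data.Product using (_×_; _,_)
open import Function using (_∘_)
open import Function.Bundles using (_⇔_; mk⇔)
open import Relation.Binary.PropositionalEquality

∁-involutive : ∀ {n} (S : Subset n) → ∁ (∁ S) ≡ S
∁-involutive S = begin
  ∁ (∁ S)             ≡⟨ map-∘ not not S ⟨
  map (not ∘ not) S   ≡⟨ map-cong not-involutive S ⟩
  map (λ b → b) S     ≡⟨ map-id S ⟩
  S                   ∎
  where open ≡-Reasoning

∁⊥≡⊤ : ∀ {n} → ∁ (⊥ {n}) ≡ ⊤
∁⊥≡⊤ = map-replicate not false _

∁⊤≡⊥ : ∀ {n} → ∁ (⊤ {n}) ≡ ⊥
∁⊤≡⊥ = map-replicate not true _

count-cong : ∀ {j} {f g : Fin j → Bool} → (∀ i → f i ≡ g i) → count f ≡ count g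
count-cong {zero}  eq = refl
count-cong {suc j} eq = cong₂ (λ b r → (if b then 1 else 0) + r) (eq zero) (count-cong (eq ∘ suc))

count-not+count : ∀ {j} (f : Fin j → Bool) → count (not ∘ f) + count f ≡ j
count-not+count {zero}  f = refl
count-not+count {suc j} f with f zero
... | true  = trans (+-suc _ _) (cong suc (count-not+count (f ∘ suc)))
... | false = cong suc (count-not+count (f ∘ suc))

count-not-cong : ∀ {j} (f g : Fin j → Bool) → count f ≡ count g → count (not ∘ f) ≡ count (not ∘ g)
count-not-cong f g eq = +-cancelʳ-≡ _ _ _ (begin
  count (not ∘ f) + count f ≡⟨ count-not+count f ⟩
  _                         ≡⟨ count-not+count g ⟨
  count (not ∘ g) + count g ≡⟨ cong (count (not ∘ g) +_) eq ⟨
  count (not ∘ g) + count f ∎)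
  where open ≡-Reasoning

module _ {n j : ℕ} (X Y : Fin j → Subset n) where

  ∁-swap-tradingTransform : IsTradingTransform X Y → IsTradingTransform (∁ ∘ Y) (∁ ∘ X)
  ∁-swap-tradingTransform tt p = begin
    count (λ i → lookup (∁ (Y i)) p)   ≡⟨ count-cong (λ i → lookup-map p not (Y i)) ⟩
    count (λ i → not (lookup (Y i) p)) ≡⟨ count-not-cong (λ i → lookup (Y i) p) (λ i → lookup (X i) p)
                                                          (sym (tt p)) ⟩
    count (λ i → not (lookup (X i) p)) ≡⟨ count-cong (λ i → lookup-map p not (X i)) ⟨
    count (λ i → lookup (∁ (X i)) p)   ∎
    where open ≡-Reasoning

  ∁-swap-certificate : ∀ (W : Subset n → Bool) →
    IsCertificate W j X Y → IsCertificate (dualW W) j (∁ ∘ Y) (∁ ∘ X)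
  ∁-swap-certificate W (tt , winX , loseY) =
    ∁-swap-tradingTransform tt , wins , loses
    where
    wins : ∀ i → not (W (∁ (∁ (Y i)))) ≡ true
    wins i rewrite ∁-involutive (Y i) | loseY i = refl
    loses : ∀ i → not (W (∁ (∁ (X i)))) ≡ false
    loses i rewrite ∁-involutive (X i) | winX i = refl

module _ {n : ℕ} (W : Subset n → Bool) {j : ℕ} where

  HasCert-dual : HasCert W j → HasCert (dualW W) j
  HasCert-dual (X , Y , c) = ∁ ∘ Y , ∁ ∘ X , ∁-swap-certificate X Y W c

  HasPotentCert-dual : HasPotentCert W j → HasPotentCert (dualW W) j
  HasPotentCert-dual (X , Y , c , (i , Xi≡⊤) , (k , Yk≡⊥)) =
    ∁ ∘ Y , ∁ ∘ X , ∁-swap-certificate X Y W c ,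
    (k , trans (cong ∁ Yk≡⊥) ∁⊥≡⊤) , (i , trans (cong ∁ Xi≡⊤) ∁⊤≡⊥)

module _ {n : ℕ} {W W′ : Subset n → Bool} (W≗W′ : ∀ S → W S ≡ W′ S) {j : ℕ} where

  IsCertificate-resp : ∀ {X Y} → IsCertificate W j X Y → IsCertificate W′ j X Y
  IsCertificate-resp (tt , winX , loseY) =
    tt , (λ i → trans (sym (W≗W′ _)) (winX i)) , (λ i → trans (sym (W≗W′ _)) (loseY i))

  HasCert-resp : HasCert W j → HasCert W′ j
  HasCert-resp (X , Y , c) = X , Y , IsCertificate-resp c

  HasPotentCert-resp : HasPotentCert W j → HasPotentCert W′ j
  HasPotentCert-resp (X , Y , c , potent) = X , Y , IsCertificate-resp c , potent

dualW-involutive : ∀ {n} (W : Subset n → Bool) (S : Subset n) → dualW (dualW W) S ≡ W S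
dualW-involutive W S rewrite ∁-involutive S = not-involutive (W S)

LeastLength-cong : ∀ {C C′ : ℕ → Set} → (∀ j → C j → C′ j) → (∀ j → C′ j → C j) →
                   ∀ v → LeastLength C v → LeastLength C′ v
LeastLength-cong to from (just j) (0<j , Cj , below) =
  0<j , to j Cj , λ k 0<k k<j C′k → below k 0<k k<j (from k C′k)
LeastLength-cong to from nothing none = λ k 0<k C′k → none k 0<k (from k C′k)

LeastLength-⇔ : ∀ {C C′ : ℕ → Set} → (∀ j → C j → C′ j) → (∀ j → C′ j → C j) →
                ∀ v → LeastLength C v ⇔ LeastLength C′ v
LeastLength-⇔ to from v = mk⇔ (LeastLength-cong to from v) (LeastLength-cong from to v)

theorem14 : ∀ {n} (G : SimpleGame n) (v : Maybe ℕ) →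
    (fIs (SimpleGame.W G) v ⇔ fIs (dualW (SimpleGame.W G)) v)
      × (gIs (SimpleGame.W G) v ⇔ gIs (dualW (SimpleGame.W G)) v)
theorem14 G v =
  LeastLength-⇔ (λ _ → HasCert-dual W) (λ _ → HasCert-resp W** ∘ HasCert-dual (dualW W)) v ,
  LeastLength-⇔ (λ _ → HasPotentCert-dual W)
                (λ _ → HasPotentCert-resp W** ∘ HasPotentCert-dual (dualW W)) v
  where
  W = SimpleGame.W G
  W** : ∀ S → dualW (dualW W) S ≡ W S
  W** = dualW-involutive W
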